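{- Let $n\ge1$ and let the partition of an $n$-element set be generated by assigning to each element a value in $\{0,1\}$ uniformly and independently, two elements being in the same block if and only if they have the same value. Then the expected number of productive queries made by any AC algorithm on this random partition is exactly $\frac{n-1}{2}$.
   Context: AC algorithm: on a finite set $S$ with an unknown set partition $P$, it adaptively asks an oracle whether two items are in the same block. Aggregated graphs: $G_0$ is the edgeless graph on $S$; each query concerns two distinct non-adjacent vertices $x,y$ of the current aggregated graph $G_t$; a negative answer adds the edge $xy$; a positive answer merges $x,y$ into one vertex adjacent to all their neighbours, labelled by the union of their labels. The algorithm stops when the aggregated graph is complete. A query is core if it receives a positive answer; it is excessive if $x$ and $y$ are joined in $G_t$ by an induced path with an even number of vertices alternating between two blocks of $P$; it is productive if it is neither core nor excessive. -}

module Defs where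

open import Data.Nat using (ℕ; zero; suc; _+_; _*_; _<_)
open import Data.Nat.DivMod using (_%_)
open import Data.Fin using (Fin; toℕ; fromℕ) renaming (zero to fzero)
open import Data.Bool using (Bool; true; false)
open import Data.Bool.Properties using () renaming (_≟_ to _≟ᵇ_)
open import Data.Product using (Σ; ∃; _×_; _,_)
open import Data.Sum using (_⊎_)
open import Data.List using (List; []; _∷_)
open import Data.List.Membership.Propositional using (_∈_)
open import Data.Vec.Functional using () renaming (_∷_ to _∷ᶠ_)
open import Relation.Nullary using (¬_; does)
open import Relation.Binary.PropositionalEquality using (_≡_; _≢_)
open import Relation.Binary.Construct.Closure.Equivalence using (EqClosure)

-- A (random) partition of S = Fin n into at most two blocks, given by a
-- 2-colouring: a and b are in the same block iff c a ≡ c b.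
Coloring : ℕ → Set
Coloring n = Fin n → Bool

sumAll : (n : ℕ) → (Coloring n → ℕ) → ℕ
sumAll zero    f = f (λ ())
sumAll (suc n) f = sumAll n (λ c → f (true ∷ᶠ c)) + sumAll n (λ c → f (false ∷ᶠ c))

-- A query between two vertices of the aggregated graph, given by one
-- element of S from the label of each vertex.
Query : ℕ → Set
Query n = Fin n × Fin n

-- History: queries asked so far together with the oracle's answers
-- (true = positive = same block).  Most recent first.
History : ℕ → Set
History n = List (Fin n × Fin n × Bool)

module _ {n : ℕ} (h : History n) where

  Pos : Fin n → Fin n → Set
  Pos x y = (x , y , true) ∈ h

  -- a and b lie in the same vertex (label) of the aggregated graph G_h
  Same : Fin n → Fin n → Set
  Same = EqClosure Pos

  Adj : Fin n → Fin n → Set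
  Adj a b = Σ (Fin n) λ u → Σ (Fin n) λ v →
            ((u , v , false) ∈ h ⊎ (v , u , false) ∈ h) × Same a u × Same v b

  Complete : Set
  Complete = (a b : Fin n) → ¬ Same a b → Adj a b

  ValidQuery : Query n → Set
  ValidQuery (x , y) = ¬ Same x y × ¬ Adj x y

  -- Induced path in G_h from the vertex of x to the vertex of y with an
  -- even number (2 + 2·half) of vertices alternating between two blocks
  -- of the partition given by c.
  record AltPath (c : Coloring n) (x y : Fin n) : Set where
    field
      half        : ℕ
      p           : Fin (suc (suc (2 * half))) → Fin n
      start       : Same (p fzero) x
      end         : Same (p (fromℕ (suc (2 * half)))) y
      distinct    : ∀ i j → i ≢ j → ¬ Same (p i) (p j)
      consecutive : ∀ i j → toℕ j ≡ suc (toℕ i) → Adj (p i) (p j)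
      induced     : ∀ i j → suc (toℕ i) < toℕ j → ¬ Adj (p i) (p j)
      altSame     : ∀ i j → toℕ i % 2 ≡ toℕ j % 2 → c (p i) ≡ c (p j)
      altDiff     : ∀ i j → toℕ i % 2 ≢ toℕ j % 2 → c (p i) ≢ c (p j)

  Excessive : Coloring n → Query n → Set
  Excessive c (x , y) = AltPath c x y

  Core : Coloring n → Query n → Set
  Core c (x , y) = c x ≡ c y

  Productive : Coloring n → Query n → Set
  Productive c q = ¬ Core c q × ¬ Excessive c q

answer : {n : ℕ} → Coloring n → Query n → Bool
answer c (x , y) = does (c x ≟ᵇ c y)

record1 : {n : ℕ} → Coloring n → Query n → Fin n × Fin n × Bool
record1 c (x , y) = (x , y , answer c (x , y))

-- A deterministic adaptive AC algorithm: the next query is a function of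
-- the whole history of queries and answers.
Strategy : ℕ → Set
Strategy n = History n → Query n

ValidStrategy : {n : ℕ} → Strategy n → Set
ValidStrategy {n} S = (h : History n) → ¬ Complete h → ValidQuery h (S h)

-- Run S c h k : running S from history h against colouring c terminates
-- (when the aggregated graph becomes complete) after making exactly k
-- productive queries.
data Run {n : ℕ} (S : Strategy n) (c : Coloring n) : History n → ℕ → Set where
  stop    : ∀ {h} → Complete h → Run S c h 0
  stepP   : ∀ {h k} → ¬ Complete h → Productive h c (S h) →
            Run S c (record1 c (S h) ∷ h) k → Run S c h (suc k)
  stepNP  : ∀ {h k} → ¬ Complete h → ¬ Productive h c (S h) →
            Run S c (record1 c (S h) ∷ h) k → Run S c h k

-- Call two elements linked in a history when a chain of queried pairs joins them. A query is
-- productive exactly when it gets a negative answer and its elements are not yet linked: if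
-- they are linked and coloured differently, a shortest walk between them in the aggregated
-- graph is an induced path along which the colouring alternates, so the query is excessive.
-- Now sum over the colourings consistent with the answers so far. A query between linked
-- elements receives the same answer from all of them. For unlinked elements, flipping the
-- colours on the class of one endpoint matches the colourings answering "same block" with those
-- answering "different blocks", and only the latter make a productive query. So if 2^(j+1)
-- colourings are consistent, the productive queries still to come total j·2^j over them, by
-- induction on the number of unresolved pairs; the count of consistent colourings is even
-- (complementing preserves consistency) and drops to 2 once the graph is complete. Initially
-- all 2^n colourings are consistent, which gives a total of (n-1)·2^(n-1).

{-# OPTIONS --safe #-}
module Submission where

open import Defs
open import Algebra.Properties.CommutativeSemigroup using (interchange)
open import Data.Bool using (Bool; true; false; not; _xor_; _∧_; if_then_else_)
open import Data.Bool.Properties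
  using (xor-same; xor-identityʳ; xor-comm; not-injective; ¬-not) renaming (_≟_ to _≟ᵇ_)
open import Data.Bool.Solver using (module xor-∧-Solver)
open import Data.Empty using (⊥; ⊥-elim)
open import Data.Fin using (Fin; toℕ; fromℕ; fromℕ<) renaming (zero to fzero; suc to fsuc)
open import Data.Fin.Properties
  using (any?; all?; toℕ<n; toℕ-fromℕ; toℕ-fromℕ<; fromℕ<-toℕ; toℕ-injective)
  renaming (_≟_ to _≟ᶠ_)
open import Data.List using ([]; _∷_)
open import Data.List.Membership.Propositional using (_∈_)
open import Data.List.Relation.Unary.All as All using (All; []; _∷_)
open import Data.List.Relation.Unary.Any using (here; there)
open import Data.Nat using (ℕ; zero; suc; pred; _+_; _*_; _∸_; _^_; _≤_; _<_; z≤n; s≤s)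
open import Data.Nat.DivMod using (_%_; _/_; m≡m%n+[m/n]*n)
open import Data.Nat.Induction using (<-wellFounded)
open import Data.Nat.Properties
open import Data.Nat.Solver using (module +-*-Solver)
open import Data.Product using (Σ; ∃; _×_; _,_; proj₁; proj₂; uncurry)
open import Data.Product.Properties using (≡-dec)
open import Data.Sum as Sum using (_⊎_; inj₁; inj₂; [_,_])
open import Data.Vec.Functional using () renaming (_∷_ to _∷ᶠ_)
open import Function.Base using (_∘_)
open import Function.Bundles using (_⇔_; mk⇔; module Equivalence)
open import Induction.WellFounded using (Acc; acc)
open import Level using (0ℓ)
open import Relation.Binary.Construct.Closure.Equivalence as EC using (EqClosure)
open import Relation.Binary.Construct.Closure.ReflexiveTransitive using (ε; _◅_; _◅◅_)
open import Relation.Binary.Construct.Closure.Symmetric using (SymClosure; fwd; bwd)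
open import Relation.Binary.Core using (Rel)
open import Relation.Binary.Definitions using (Decidable; DecidableEquality; tri<; tri≈; tri>)
open import Relation.Binary.PropositionalEquality
  using (_≡_; _≢_; ≢-sym; _≗_; refl; sym; trans; cong; cong₂; subst; subst₂; module ≡-Reasoning)
open import Relation.Binary.PropositionalEquality.Properties using () renaming (isEquivalence to ≡-isEquivalence)
open import Relation.Binary.Structures using (IsEquivalence)
open import Relation.Nullary using (¬_; Dec; yes; no; does)
open import Relation.Nullary.Decidable
  using (does-⇔; dec-true; dec-false; map′; _×-dec_; _⊎-dec_; _→-dec_; ¬?)

open Equivalence using (to; from)

_⊕_ : ∀ {n} → Coloring n → Coloring n → Coloring n
(c ⊕ d) a = c a xor d a

does-≟ : ∀ p q → does (p ≟ᵇ q) ≡ not (p xor q)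
does-≟ false false = refl
does-≟ false true  = refl
does-≟ true  false = refl
does-≟ true  true  = refl

xor≡false⇒≡ : ∀ {p q} → p xor q ≡ false → p ≡ q
xor≡false⇒≡ {false} {false} _ = refl
xor≡false⇒≡ {true}  {true}  _ = refl

xor≡false⇔≡ : ∀ {p q} → p xor q ≡ false ⇔ p ≡ q
xor≡false⇔≡ {p} = mk⇔ xor≡false⇒≡ λ { refl → xor-same p }

module _ {n : ℕ} where
  open xor-∧-Solver using (solve; _:+_; con; _:=_)
  open ≡-Reasoning

  answer-⊕ : (c d : Coloring n) (a b : Fin n) →
             answer (c ⊕ d) (a , b) ≡ answer c (a , b) xor (d a xor d b)
  answer-⊕ c d a b = begin
    does (c a xor d a ≟ᵇ c b xor d b)      ≡⟨ does-≟ (c a xor d a) (c b xor d b) ⟩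
    not ((c a xor d a) xor (c b xor d b))  ≡⟨ regroup (c a) (d a) (c b) (d b) ⟩
    not (c a xor c b) xor (d a xor d b)    ≡⟨ cong (_xor (d a xor d b)) (does-≟ (c a) (c b)) ⟨
    answer c (a , b) xor (d a xor d b)     ∎
    where
    -- not p is definitionally true xor p, so this is an identity of Boolean rings.
    regroup = solve 4 (λ p r q s → con true :+ ((p :+ r) :+ (q :+ s))
                                 := (con true :+ (p :+ q)) :+ (r :+ s)) refl

  answers-xor : (c c′ : Coloring n) (a b : Fin n) →
                answer c (a , b) xor answer c′ (a , b) ≡ (c ⊕ c′) a xor (c ⊕ c′) b
  answers-xor c c′ a b = begin
    answer c (a , b) xor answer c′ (a , b)
      ≡⟨ cong₂ _xor_ (does-≟ (c a) (c b)) (does-≟ (c′ a) (c′ b)) ⟩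
    not (c a xor c b) xor not (c′ a xor c′ b)   ≡⟨ regroup (c a) (c b) (c′ a) (c′ b) ⟩
    (c a xor c′ a) xor (c b xor c′ b)           ∎
    where
    regroup = solve 4 (λ p q p′ q′ → (con true :+ (p :+ q)) :+ (con true :+ (p′ :+ q′))
                                   := (p :+ p′) :+ (q :+ q′)) refl

  answers-agree⇔ : (c c′ : Coloring n) (a b : Fin n) →
                   answer c (a , b) ≡ answer c′ (a , b) ⇔ (c ⊕ c′) a ≡ (c ⊕ c′) b
  answers-agree⇔ c c′ a b = mk⇔
    (λ agree → to xor≡false⇔≡ (trans (sym (answers-xor c c′ a b)) (from xor≡false⇔≡ agree)))
    (λ agree → to xor≡false⇔≡ (trans (answers-xor c c′ a b) (from xor≡false⇔≡ agree)))

-- Sums over all colourings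

sumWith₀ : ∀ n → (Coloring (suc n) → ℕ) → Bool → ℕ
sumWith₀ n f b = sumAll n (f ∘ (b ∷ᶠ_))

Respects≗ : ∀ {n} → (Coloring n → ℕ) → Set
Respects≗ f = ∀ {c c′} → c ≗ c′ → f c ≡ f c′

sumAll-cong : ∀ n {f g : Coloring n → ℕ} → f ≗ g → sumAll n f ≡ sumAll n g
sumAll-cong zero    f≗g = f≗g _
sumAll-cong (suc n) f≗g =
  cong₂ _+_ (sumAll-cong n (f≗g ∘ (true ∷ᶠ_))) (sumAll-cong n (f≗g ∘ (false ∷ᶠ_)))

sumAll-+ : ∀ n (f g : Coloring n → ℕ) → sumAll n (λ c → f c + g c) ≡ sumAll n f + sumAll n g
sumAll-+ zero    f g = refl
sumAll-+ (suc n) f g = trans (cong₂ _+_ (half true) (half false))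
  (interchange +-commutativeSemigroup
     (sumWith₀ n f true) (sumWith₀ n g true) (sumWith₀ n f false) (sumWith₀ n g false))
  where
  half : ∀ b → sumWith₀ n (λ c → f c + g c) b ≡ sumWith₀ n f b + sumWith₀ n g b
  half b = sumAll-+ n (f ∘ (b ∷ᶠ_)) (g ∘ (b ∷ᶠ_))

sumAll-const : ∀ n k → sumAll n (λ _ → k) ≡ 2 ^ n * k
sumAll-const zero    k = sym (+-identityʳ k)
sumAll-const (suc n) k = trans (cong₂ _+_ (sumAll-const n k) (sumAll-const n k)) (double (2 ^ n) k)
  where
  open +-*-Solver using (solve; _:+_; _:*_; con; _:=_)
  double = solve 2 (λ p k → p :* k :+ p :* k := (con 2 :* p) :* k) refl

sumAll-witness : ∀ n (f : Coloring n → ℕ) → sumAll n f ≢ 0 → ∃ λ c → f c ≢ 0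
sumAll-witness zero    f sum≢0 = _ , sum≢0
sumAll-witness (suc n) f sum≢0 with sumWith₀ n f true ≟ 0
... | no  A≢0 = let (c , fc≢0) = sumAll-witness n _ A≢0 in true ∷ᶠ c , fc≢0
... | yes A≡0 = let (c , fc≢0) = sumAll-witness n _ (λ B≡0 → sum≢0 (cong₂ _+_ A≡0 B≡0)) in
                false ∷ᶠ c , fc≢0

⊕-∷ : ∀ {n} b (c : Coloring n) (d : Coloring (suc n)) →
      (b ∷ᶠ c) ⊕ d ≗ (b xor d fzero) ∷ᶠ (c ⊕ (d ∘ fsuc))
⊕-∷ b c d fzero    = refl
⊕-∷ b c d (fsuc i) = refl

∷-cong : ∀ {n} b {c c′ : Coloring n} → c ≗ c′ → (b ∷ᶠ c) ≗ (b ∷ᶠ c′)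
∷-cong b c≗c′ fzero    = refl
∷-cong b c≗c′ (fsuc i) = c≗c′ i

sumAll-⊕ : ∀ n (f : Coloring n → ℕ) → Respects≗ f → (d : Coloring n) →
           sumAll n (λ c → f (c ⊕ d)) ≡ sumAll n f
sumWith₀-⊕ : ∀ n (f : Coloring (suc n) → ℕ) → Respects≗ f → ∀ b (d : Coloring (suc n)) →
             sumWith₀ n (λ c → f (c ⊕ d)) b ≡ sumWith₀ n f (b xor d fzero)

sumAll-⊕ zero    f resp d = resp (λ ())
sumAll-⊕ (suc n) f resp d =
  trans (cong₂ _+_ (sumWith₀-⊕ n f resp true d) (sumWith₀-⊕ n f resp false d)) (halves (d fzero))
  where
  halves : ∀ x → sumWith₀ n f (true xor x) + sumWith₀ n f (false xor x) ≡ sumAll (suc n) f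
  halves false = refl
  halves true  = +-comm (sumWith₀ n f false) (sumWith₀ n f true)

sumWith₀-⊕ n f resp b d = trans (sumAll-cong n (λ c → resp (⊕-∷ b c d)))
  (sumAll-⊕ n (f ∘ ((b xor d fzero) ∷ᶠ_)) (resp ∘ ∷-cong _) (d ∘ fsuc))

sumAll-complement : ∀ n (f : Coloring (suc n) → ℕ) → Respects≗ f →
                    (∀ c → f (c ⊕ (λ _ → true)) ≡ f c) → sumAll (suc n) f ≡ 2 * sumWith₀ n f true
sumAll-complement n f resp f-complement =
  cong (sumWith₀ n f true +_) (trans B≡A (sym (+-identityʳ _)))
  where
  B≡A : sumWith₀ n f false ≡ sumWith₀ n f true
  B≡A = trans (sumAll-cong n (sym ∘ f-complement ∘ (false ∷ᶠ_)))
              (sumWith₀-⊕ n f resp false (λ _ → true))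

+-≤1 : ∀ {a b} → a ≤ 1 → b ≤ 1 → (a ≢ 0 → b ≢ 0 → ⊥) → a + b ≤ 1
+-≤1 z≤n       b≤1       _    = b≤1
+-≤1 (s≤s z≤n) z≤n       _    = s≤s z≤n
+-≤1 (s≤s z≤n) (s≤s z≤n) both = ⊥-elim (both (λ ()) (λ ()))

sumAll-≤1 : ∀ n (f : Coloring n → ℕ) → (∀ c → f c ≤ 1) →
            (∀ c c′ → f c ≢ 0 → f c′ ≢ 0 → c ≗ c′) → sumAll n f ≤ 1
sumAll-≤1 zero    f f≤1 unique = f≤1 _
sumAll-≤1 (suc n) f f≤1 unique = +-≤1 (half true) (half false) λ A≢0 B≢0 →
  let (c , fc≢0) = sumAll-witness n _ A≢0 ; (c′ , fc′≢0) = sumAll-witness n _ B≢0 in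
  true≢false (unique _ _ fc≢0 fc′≢0 fzero)
  where
  true≢false : true ≢ false
  true≢false ()
  half : ∀ b → sumWith₀ n f b ≤ 1
  half b = sumAll-≤1 n _ (f≤1 ∘ (b ∷ᶠ_)) λ c c′ fc≢0 fc′≢0 i → unique _ _ fc≢0 fc′≢0 (fsuc i)

-- Equivalence closures

EqClosure-empty? : {A : Set} {R : Rel A 0ℓ} → DecidableEquality A → (∀ {a b} → ¬ R a b) →
                   Decidable (EqClosure R)
EqClosure-empty? _≟_ ¬R a b = map′ (λ { refl → ε }) (EC.fold ≡-isEquivalence (⊥-elim ∘ ¬R)) (a ≟ b)

module EqClosure-insert {A : Set} {R R′ : Rel A 0ℓ} {x y : A}
  (R⇒R′ : ∀ {a b} → R a b → R′ a b) (xR′y : R′ x y)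
  (R′⇒R⊎xy : ∀ {a b} → R′ a b → R a b ⊎ (a ≡ x × b ≡ y)) where

  Near : A → Set
  Near a = EqClosure R a x ⊎ EqClosure R a y

  Merged : Rel A 0ℓ
  Merged a b = EqClosure R a b ⊎ (Near a × Near b)

  near-resp : ∀ {a b} → EqClosure R a b → Near b → Near a
  near-resp p (inj₁ q) = inj₁ (p ◅◅ q)
  near-resp p (inj₂ q) = inj₂ (p ◅◅ q)

  merged-isEquivalence : IsEquivalence Merged
  merged-isEquivalence = record { refl = inj₁ ε ; sym = sym′ ; trans = trans′ }
    where
    sym′ : ∀ {a b} → Merged a b → Merged b a
    sym′ (inj₁ p)         = inj₁ (EC.symmetric R p)
    sym′ (inj₂ (na , nb)) = inj₂ (nb , na)
    trans′ : ∀ {a b c} → Merged a b → Merged b c → Merged a c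
    trans′ (inj₁ p)         (inj₁ q)         = inj₁ (p ◅◅ q)
    trans′ (inj₁ p)         (inj₂ (nb , nc)) = inj₂ (near-resp p nb , nc)
    trans′ (inj₂ (na , nb)) (inj₁ q)         = inj₂ (na , near-resp (EC.symmetric R q) nb)
    trans′ (inj₂ (na , _))  (inj₂ (_ , nc))  = inj₂ (na , nc)

  to-merged : ∀ {a b} → EqClosure R′ a b → Merged a b
  to-merged = EC.fold merged-isEquivalence step
    where
    step : ∀ {a b} → R′ a b → Merged a b
    step r with R′⇒R⊎xy r
    ... | inj₁ r′            = inj₁ (EC.return r′)
    ... | inj₂ (refl , refl) = inj₂ (inj₁ ε , inj₂ ε)

  from-merged : ∀ {a b} → Merged a b → EqClosure R′ a b
  from-merged (inj₁ p)         = EC.map R⇒R′ p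
  from-merged (inj₂ (na , nb)) = near⇒x na ◅◅ EC.symmetric R′ (near⇒x nb)
    where
    near⇒x : ∀ {a} → Near a → EqClosure R′ a x
    near⇒x (inj₁ p) = EC.map R⇒R′ p
    near⇒x (inj₂ p) = EC.map R⇒R′ p ◅◅ EC.symmetric R′ (EC.return xR′y)

  decidable : Decidable (EqClosure R) → Decidable (EqClosure R′)
  decidable _≈?_ a b = map′ from-merged to-merged
    (a ≈? b ⊎-dec ((a ≈? x ⊎-dec a ≈? y) ×-dec (b ≈? x ⊎-dec b ≈? y)))

-- The aggregated graph of a history

∑ : ∀ {m} → (Fin m → ℕ) → ℕ
∑ {zero}  f = 0
∑ {suc m} f = f fzero + ∑ (f ∘ fsuc)

∑-mono : ∀ {m} {f g : Fin m → ℕ} → (∀ i → f i ≤ g i) → ∑ f ≤ ∑ g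
∑-mono {zero}  f≤g = z≤n
∑-mono {suc m} f≤g = +-mono-≤ (f≤g fzero) (∑-mono (f≤g ∘ fsuc))

∑-mono-< : ∀ {m} {f g : Fin m → ℕ} → (∀ i → f i ≤ g i) → ∀ i → f i < g i → ∑ f < ∑ g
∑-mono-< f≤g fzero    f<g = +-mono-<-≤ f<g (∑-mono (f≤g ∘ fsuc))
∑-mono-< f≤g (fsuc i) f<g = +-mono-≤-< (f≤g fzero) (∑-mono-< (f≤g ∘ fsuc) i f<g)

[¬_] : {P : Set} → Dec P → ℕ
[¬ yes _ ] = 0
[¬ no _ ]  = 1

[¬]-antitone : {P Q : Set} → (P → Q) → (p : Dec P) (q : Dec Q) → [¬ q ] ≤ [¬ p ]
[¬]-antitone P⇒Q (yes P) (yes _) = z≤n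
[¬]-antitone P⇒Q (yes P) (no ¬Q) = ⊥-elim (¬Q (P⇒Q P))
[¬]-antitone P⇒Q (no _)  (yes _) = z≤n
[¬]-antitone P⇒Q (no _)  (no _)  = s≤s z≤n

[¬]-strict : {P Q : Set} → ¬ P → Q → (p : Dec P) (q : Dec Q) → [¬ q ] < [¬ p ]
[¬]-strict ¬P Q (yes P) _       = ⊥-elim (¬P P)
[¬]-strict ¬P Q (no _)  (yes _) = s≤s z≤n
[¬]-strict ¬P Q (no _)  (no ¬Q) = ⊥-elim (¬Q Q)

module _ {n : ℕ} where

  Link : History n → Rel (Fin n) 0ℓ
  Link h a b = ∃ λ t → (a , b , t) ∈ h

  Conn : History n → Rel (Fin n) 0ℓ
  Conn h = EqClosure (Link h)

  Resolved : History n → Rel (Fin n) 0ℓ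
  Resolved h a b = Same h a b ⊎ Adj h a b

  Same? : (h : History n) → Decidable (Same h)
  Same? []                    = EqClosure-empty? _≟ᶠ_ λ ()
  Same? ((x , y , true) ∷ h)  = EqClosure-insert.decidable there (here refl) split (Same? h)
    where
    split : ∀ {a b} → Pos ((x , y , true) ∷ h) a b → Pos h a b ⊎ (a ≡ x × b ≡ y)
    split (here refl) = inj₂ (refl , refl)
    split (there p)   = inj₁ p
  Same? ((x , y , false) ∷ h) a b = map′ (EC.map there) (EC.map λ { (there p) → p }) (Same? h a b)

  Conn? : (h : History n) → Decidable (Conn h)
  Conn? []                = EqClosure-empty? _≟ᶠ_ λ { (_ , ()) }
  Conn? ((x , y , t) ∷ h) =
    EqClosure-insert.decidable (λ (t′ , p) → t′ , there p) (t , here refl) split (Conn? h)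
    where
    split : ∀ {a b} → Link ((x , y , t) ∷ h) a b → Link h a b ⊎ (a ≡ x × b ≡ y)
    split (_ , here refl) = inj₂ (refl , refl)
    split (t′ , there p)  = inj₁ (t′ , p)

  open import Data.List.Membership.DecPropositional (≡-dec (_≟ᶠ_ {n}) (≡-dec (_≟ᶠ_ {n}) _≟ᵇ_))
    using (_∈?_)

  Adj? : (h : History n) → Decidable (Adj h)
  Adj? h a b = any? λ u → any? λ v →
    (((u , v , false) ∈? h) ⊎-dec ((v , u , false) ∈? h)) ×-dec Same? h a u ×-dec Same? h v b

  Complete? : (h : History n) → Dec (Complete h)
  Complete? h = all? λ a → all? λ b → ¬? (Same? h a b) →-dec Adj? h a b

  Resolved? : (h : History n) → Decidable (Resolved h)
  Resolved? h a b = Same? h a b ⊎-dec Adj? h a b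

  Same⇒Conn : ∀ {h : History n} {a b} → Same h a b → Conn h a b
  Same⇒Conn = EC.map (true ,_)

  Adj⇒Conn : ∀ {h : History n} {a b} → Adj h a b → Conn h a b
  Adj⇒Conn {h} (u , v , uv , a~u , v~b) = Same⇒Conn a~u ◅◅ edge uv ◅◅ Same⇒Conn v~b
    where
    edge : ∀ {u v} → (u , v , false) ∈ h ⊎ (v , u , false) ∈ h → Conn h u v
    edge (inj₁ p) = EC.return (false , p)
    edge (inj₂ p) = EC.symmetric (Link h) (EC.return (false , p))

  Adj-respˡ : ∀ {h : History n} {a a′ b} → Same h a a′ → Adj h a′ b → Adj h a b
  Adj-respˡ a~a′ (u , v , uv , a′~u , v~b) = u , v , uv , a~a′ ◅◅ a′~u , v~b

  Adj-respʳ : ∀ {h : History n} {a b b′} → Adj h a b′ → Same h b′ b → Adj h a b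
  Adj-respʳ (u , v , uv , a~u , v~b′) b′~b = u , v , uv , a~u , v~b′ ◅◅ b′~b

  Link⇒Resolved : ∀ {h : History n} {a b} → SymClosure (Link h) a b → Resolved h a b
  Link⇒Resolved         (fwd (true , p))  = inj₁ (EC.return p)
  Link⇒Resolved {a = a} {b} (fwd (false , p)) = inj₂ (a , b , inj₁ p , ε , ε)
  Link⇒Resolved {h}     (bwd (true , p))  = inj₁ (EC.symmetric (Pos h) (EC.return p))
  Link⇒Resolved {a = a} {b} (bwd (false , p)) = inj₂ (a , b , inj₂ p , ε , ε)

  Resolved-mono : ∀ {h : History n} r {a b} → Resolved h a b → Resolved (r ∷ h) a b
  Resolved-mono r (inj₁ a~b)                       = inj₁ (EC.map there a~b)
  Resolved-mono r (inj₂ (u , v , uv , a~u , v~b)) =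
    inj₂ (u , v , Sum.map there there uv , EC.map there a~u , EC.map there v~b)

  Resolved-query : ∀ {h : History n} x y t → Resolved ((x , y , t) ∷ h) x y
  Resolved-query x y true  = inj₁ (EC.return (here refl))
  Resolved-query x y false = inj₂ (x , y , inj₁ (here refl) , ε , ε)

  unresolved : History n → ℕ
  unresolved h = ∑ λ a → ∑ λ b → [¬ Resolved? h a b ]

  unresolved-query : ∀ {h x y} t → ValidQuery h (x , y) → unresolved ((x , y , t) ∷ h) < unresolved h
  unresolved-query {h} {x} {y} t (¬x~y , ¬x—y) =
    ∑-mono-< (λ a → ∑-mono (fewer a)) x (∑-mono-< (fewer x) y newly-resolved)
    where
    h′ = (x , y , t) ∷ h
    fewer : ∀ a b → [¬ Resolved? h′ a b ] ≤ [¬ Resolved? h a b ]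
    fewer a b = [¬]-antitone (Resolved-mono _) (Resolved? h a b) (Resolved? h′ a b)
    newly-resolved : [¬ Resolved? h′ x y ] < [¬ Resolved? h x y ]
    newly-resolved =
      [¬]-strict [ ¬x~y , ¬x—y ] (Resolved-query {h} x y t) (Resolved? h x y) (Resolved? h′ x y)

-- Colourings consistent with a history

module _ {n : ℕ} where

  Answered : Coloring n → Fin n × Fin n × Bool → Set
  Answered c (a , b , t) = answer c (a , b) ≡ t

  Consistent : History n → Coloring n → Set
  Consistent h c = All (Answered c) h

  consistent? : (h : History n) (c : Coloring n) → Dec (Consistent h c)
  consistent? h c = All.all? (λ (a , b , t) → answer c (a , b) ≟ᵇ t) h

  Consistent-cong : ∀ {h} {c c′ : Coloring n} →
                    (∀ {a b t} → (a , b , t) ∈ h → answer c (a , b) ≡ answer c′ (a , b)) →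
                    Consistent h c ⇔ Consistent h c′
  Consistent-cong same = mk⇔
    (λ cons → All.tabulate λ r → trans (sym (same r)) (All.lookup cons r))
    (λ cons → All.tabulate λ r → trans (same r) (All.lookup cons r))

  Consistent-≗ : ∀ {h} {c c′ : Coloring n} → c ≗ c′ → Consistent h c ⇔ Consistent h c′
  Consistent-≗ {c = c} {c′} c≗c′ = Consistent-cong {c = c} {c′} λ {a} {b} _ →
    cong₂ (λ p q → does (p ≟ᵇ q)) (c≗c′ a) (c≗c′ b)

  Consistent-⊕ : ∀ {h} (c d : Coloring n) → (∀ {a b t} → (a , b , t) ∈ h → d a ≡ d b) →
                 Consistent h (c ⊕ d) ⇔ Consistent h c
  Consistent-⊕ c d d-const = Consistent-cong {c = c ⊕ d} {c} λ {a} {b} r → begin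
    answer (c ⊕ d) (a , b)              ≡⟨ answer-⊕ c d a b ⟩
    answer c (a , b) xor (d a xor d b)  ≡⟨ cong (λ e → answer c (a , b) xor (e xor d b)) (d-const r) ⟩
    answer c (a , b) xor (d b xor d b)  ≡⟨ cong (answer c (a , b) xor_) (xor-same (d b)) ⟩
    answer c (a , b) xor false          ≡⟨ xor-identityʳ _ ⟩
    answer c (a , b)                    ∎
    where open ≡-Reasoning

  answer≡true⇒≡ : ∀ c {a b : Fin n} → answer c (a , b) ≡ true → c a ≡ c b
  answer≡true⇒≡ c {a} {b} _ with c a ≟ᵇ c b
  ... | yes ca≡cb = ca≡cb

  answer≡false⇒≢ : ∀ c {a b : Fin n} → answer c (a , b) ≡ false → c a ≢ c b
  answer≡false⇒≢ c {a} {b} _ with c a ≟ᵇ c b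
  ... | no ca≢cb = ca≢cb

  module _ {h : History n} (c : Coloring n) (cons : Consistent h c) where

    Same⇒≡ : ∀ {a b} → Same h a b → c a ≡ c b
    Same⇒≡ = EC.gfold ≡-isEquivalence c λ p → answer≡true⇒≡ c (All.lookup cons p)

    Adj⇒≢ : ∀ {a b} → Adj h a b → c a ≢ c b
    Adj⇒≢ (u , v , uv , a~u , v~b) ca≡cb =
      edge uv (trans (sym (Same⇒≡ a~u)) (trans ca≡cb (sym (Same⇒≡ v~b))))
      where
      edge : (u , v , false) ∈ h ⊎ (v , u , false) ∈ h → c u ≢ c v
      edge (inj₁ p) = answer≡false⇒≢ c (All.lookup cons p)
      edge (inj₂ p) = answer≡false⇒≢ c (All.lookup cons p) ∘ sym

    Conn⇒⊕-≡ : ∀ {c′} → Consistent h c′ → ∀ {a b} → Conn h a b → (c ⊕ c′) a ≡ (c ⊕ c′) b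
    Conn⇒⊕-≡ {c′} cons′ = EC.gfold ≡-isEquivalence (c ⊕ c′) λ {a} {b} (_ , p) →
      to (answers-agree⇔ c c′ a b) (trans (All.lookup cons p) (sym (All.lookup cons′ p)))

  complete-rigid : ∀ {h} {c c′ : Coloring n} → Complete h → Consistent h c → Consistent h c′ →
                   ∀ z → c z ≡ c′ z → c ≗ c′
  complete-rigid {h} {c} {c′} done cons cons′ z cz≡c′z a = xor≡false⇒≡ (begin
    c a xor c′ a   ≡⟨ Conn⇒⊕-≡ c cons cons′ z~a ⟨
    c z xor c′ z   ≡⟨ cong (_xor c′ z) cz≡c′z ⟩
    c′ z xor c′ z  ≡⟨ xor-same (c′ z) ⟩
    false          ∎)
    where
    open ≡-Reasoning
    z~a : Conn h z a
    z~a with Same? h z a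
    ... | yes z~a = Same⇒Conn z~a
    ... | no ¬z~a = Adj⇒Conn (done z a ¬z~a)

-- Induced alternating paths from walks

parity : ∀ k → k % 2 ≡ 0 ⊎ k % 2 ≡ 1
parity zero          = inj₁ refl
parity (suc zero)    = inj₂ refl
parity (suc (suc k)) = parity k

module _ {n : ℕ} (h : History n) where

  record Walk (x y : Fin n) : Set where
    field
      len    : ℕ
      vertex : ℕ → Fin n
      start  : Same h x (vertex 0)
      end    : Same h (vertex len) y
      step   : ∀ i → i < len → Adj h (vertex i) (vertex (suc i))

  open Walk

  _◃_ : ∀ {a b y} → Resolved h a b → Walk b y → Walk a y
  inj₁ a~b ◃ w = record
    { len = len w ; vertex = vertex w ; start = a~b ◅◅ start w ; end = end w ; step = step w }
  _◃_ {a} (inj₂ a—b) w = record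
    { len    = suc (len w)
    ; vertex = λ { zero → a ; (suc i) → vertex w i }
    ; start  = ε
    ; end    = end w
    ; step   = λ { zero _ → Adj-respʳ a—b (start w) ; (suc i) (s≤s i<len) → step w i i<len }
    }

  Conn⇒Walk : ∀ {x y} → Conn h x y → Walk x y
  Conn⇒Walk {x} ε    = record { len = 0 ; vertex = λ _ → x ; start = ε ; end = ε ; step = λ _ () }
  Conn⇒Walk (l ◅ ls) = Link⇒Resolved l ◃ Conn⇒Walk ls

  Shortcut : ∀ {x y} → Walk x y → ℕ → ℕ → Set
  Shortcut w i j = i < j × j ≤ len w ×
    (Same h (vertex w i) (vertex w j) ⊎ (suc i < j × Adj h (vertex w i) (vertex w j)))

  Induced : ∀ {x y} → Walk x y → Set
  Induced w = ∀ i j → ¬ Shortcut w i j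

  shortcut? : ∀ {x y} (w : Walk x y) i j → Dec (Shortcut w i j)
  shortcut? w i j = i <? j ×-dec j ≤? len w ×-dec
    (Same? h (vertex w i) (vertex w j) ⊎-dec (suc i <? j ×-dec Adj? h (vertex w i) (vertex w j)))

  module _ {x y} (w : Walk x y) where

    truncate : ∀ i → i < len w → Same h (vertex w i) (vertex w (len w)) →
               Σ (Walk x y) λ w′ → len w′ < len w
    truncate i i<len vᵢ~vₗₑₙ = record
      { len    = i
      ; vertex = vertex w
      ; start  = start w
      ; end    = vᵢ~vₗₑₙ ◅◅ end w
      ; step   = λ k k<i → step w k (<-trans k<i i<len)
      } , i<len

    skip : ∀ i j → suc i < j → j ≤ len w → Adj h (vertex w i) (vertex w j) →
           Σ (Walk x y) λ w′ → len w′ < len w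
    skip i j i+1<j j≤len vᵢ—vⱼ = w′ , ∸-monoʳ-< (m<n⇒0<n∸m i+1<j) d≤len
      where
      d = j ∸ suc i
      i+1+d≡j : suc i + d ≡ j
      i+1+d≡j = m+[n∸m]≡n (<⇒≤ i+1<j)
      d≤len : d ≤ len w
      d≤len = ≤-trans (m∸n≤m j (suc i)) j≤len
      i<len∸d : i < len w ∸ d
      i<len∸d = m+n≤o⇒m≤o∸n (suc i) (subst (_≤ len w) (sym i+1+d≡j) j≤len)

      v : ℕ → Fin n
      v k with k ≤? i
      ... | yes _ = vertex w k
      ... | no  _ = vertex w (k + d)

      v-≤ : ∀ {k} → k ≤ i → v k ≡ vertex w k
      v-≤ {k} k≤i with k ≤? i
      ... | yes _   = refl
      ... | no  k≰i = ⊥-elim (k≰i k≤i)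

      v-> : ∀ {k} → i < k → v k ≡ vertex w (k + d)
      v-> {k} i<k with k ≤? i
      ... | yes k≤i = ⊥-elim (<⇒≱ i<k k≤i)
      ... | no  _   = refl

      step′ : ∀ k → k < len w ∸ d → Adj h (v k) (v (suc k))
      step′ k k<len∸d with <-cmp k i
      ... | tri< k<i _ _  = subst₂ (Adj h) (sym (v-≤ (<⇒≤ k<i))) (sym (v-≤ k<i))
                              (step w k (<-trans k<i (<-≤-trans i<len∸d (m∸n≤m (len w) d))))
      ... | tri≈ _ refl _ = subst₂ (Adj h) (sym (v-≤ ≤-refl))
                              (sym (trans (v-> ≤-refl) (cong (vertex w) i+1+d≡j))) vᵢ—vⱼ
      ... | tri> _ _ i<k  = subst₂ (Adj h) (sym (v-> i<k)) (sym (v-> (<-trans i<k (n<1+n k))))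
                              (step w (k + d) (m≤o∸n⇒m+n≤o (suc k) d≤len k<len∸d))

      w′ : Walk x y
      w′ = record
        { len    = len w ∸ d
        ; vertex = v
        ; start  = subst (Same h x) (sym (v-≤ z≤n)) (start w)
        ; end    = subst (λ u → Same h u y)
                         (sym (trans (v-> i<len∸d) (cong (vertex w) (m∸n+n≡m d≤len)))) (end w)
        ; step   = step′
        }

    remove-shortcut : ∀ {i j} → Shortcut w i j → Σ (Walk x y) λ w′ → len w′ < len w
    remove-shortcut {i} {j} (i<j , j≤len , inj₂ (i+1<j , vᵢ—vⱼ)) = skip i j i+1<j j≤len vᵢ—vⱼ
    remove-shortcut {i} {j} (i<j , j≤len , inj₁ vᵢ~vⱼ) with j ≟ len w
    ... | yes refl  = truncate i i<j vᵢ~vⱼ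
    ... | no  j≢len = skip i (suc j) (s≤s i<j) j<len (Adj-respˡ vᵢ~vⱼ (step w j j<len))
      where j<len = ≤∧≢⇒< j≤len j≢len

  induce : ∀ {x y} (w : Walk x y) → Acc _<_ (len w) → Σ (Walk x y) Induced
  induce w (acc shorter) with anyUpTo? (λ i → anyUpTo? (shortcut? w i) (suc (len w))) (suc (len w))
  ... | yes (_ , _ , _ , _ , sc) = let (w′ , w′<w) = remove-shortcut w sc in induce w′ (shorter w′<w)
  ... | no  none                 = w , λ i j sc@(i<j , j≤len , _) →
    none (i , s≤s (≤-trans (<⇒≤ i<j) j≤len) , j , s≤s j≤len , sc)

  module _ {c : Coloring n} (cons : Consistent h c) {x y} (w : Walk x y) where

    colour-period : ∀ k → k ≤ len w → c (vertex w k) ≡ c (vertex w (k % 2))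
    colour-period zero          _       = refl
    colour-period (suc zero)    _       = refl
    colour-period (suc (suc k)) k+2≤len = trans two-flips (colour-period k (≤-trans (n≤1+n k) k+1≤len))
      where
      k+1≤len = ≤-trans (n≤1+n (suc k)) k+2≤len
      two-flips : c (vertex w (suc (suc k))) ≡ c (vertex w k)
      two-flips = trans (¬-not (≢-sym (Adj⇒≢ c cons (step w (suc k) k+2≤len))))
                        (sym (¬-not (Adj⇒≢ c cons (step w k k+1≤len))))

    colour-at : ∀ {k r} → k ≤ len w → k % 2 ≡ r → c (vertex w k) ≡ c (vertex w r)
    colour-at {k} k≤len k%2≡r = trans (colour-period k k≤len) (cong (c ∘ vertex w) k%2≡r)

    colour-alternates : ∀ {k l} → 0 < len w → k ≤ len w → l ≤ len w → k % 2 ≢ l % 2 →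
                        c (vertex w k) ≢ c (vertex w l)
    colour-alternates {k} {l} 0<len k≤len l≤len k≢l cₖ≡cₗ with parity k | parity l
    ... | inj₁ k₀ | inj₁ l₀ = k≢l (trans k₀ (sym l₀))
    ... | inj₂ k₁ | inj₂ l₁ = k≢l (trans k₁ (sym l₁))
    ... | inj₁ k₀ | inj₂ l₁ = Adj⇒≢ c cons (step w 0 0<len)
                                (trans (sym (colour-at k≤len k₀)) (trans cₖ≡cₗ (colour-at l≤len l₁)))
    ... | inj₂ k₁ | inj₁ l₀ = Adj⇒≢ c cons (step w 0 0<len)
                                (trans (sym (colour-at l≤len l₀)) (trans (sym cₖ≡cₗ) (colour-at k≤len k₁)))

    odd-length : c x ≢ c y → len w ≡ suc (2 * (len w / 2))
    odd-length cx≢cy = trans (m≡m%n+[m/n]*n (len w) 2) (cong₂ _+_ len-odd (*-comm (len w / 2) 2))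
      where
      len-odd : len w % 2 ≡ 1
      len-odd with parity (len w)
      ... | inj₂ odd  = odd
      ... | inj₁ even = ⊥-elim (cx≢cy (begin
        c x                   ≡⟨ Same⇒≡ c cons (start w) ⟩
        c (vertex w 0)        ≡⟨ colour-at ≤-refl even ⟨
        c (vertex w (len w))  ≡⟨ Same⇒≡ c cons (end w) ⟩
        c y                   ∎))
        where open ≡-Reasoning

    Induced⇒AltPath : Induced w → c x ≢ c y → AltPath h c x y
    Induced⇒AltPath induced cx≢cy = record
      { half        = len w / 2
      ; p           = vertex w ∘ toℕ
      ; start       = EC.symmetric (Pos h) (start w)
      ; end         = subst (λ k → Same h (vertex w k) y) (sym (trans (toℕ-fromℕ _) (sym len≡))) (end w)
      ; distinct    = distinct
      ; consecutive = λ i j j≡i+1 → subst (λ k → Adj h (vertex w (toℕ i)) (vertex w k)) (sym j≡i+1)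
                                      (step w (toℕ i) (subst (_≤ len w) j≡i+1 (bound j)))
      ; induced     = λ i j i+1<j vᵢ—vⱼ →
                        induced (toℕ i) (toℕ j) (<-trans (n<1+n _) i+1<j , bound j , inj₂ (i+1<j , vᵢ—vⱼ))
      ; altSame     = λ i j i≡j → trans (colour-at (bound i) i≡j) (sym (colour-at (bound j) refl))
      ; altDiff     = λ i j → colour-alternates (subst (0 <_) (sym len≡) (s≤s z≤n)) (bound i) (bound j)
      }
      where
      len≡ = odd-length cx≢cy
      bound : ∀ (i : Fin (suc (suc (2 * (len w / 2))))) → toℕ i ≤ len w
      bound i = subst (toℕ i ≤_) (sym len≡) (≤-pred (toℕ<n i))
      distinct : ∀ i j → i ≢ j → ¬ Same h (vertex w (toℕ i)) (vertex w (toℕ j))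
      distinct i j i≢j with <-cmp (toℕ i) (toℕ j)
      ... | tri< i<j _ _ = λ vᵢ~vⱼ → induced _ _ (i<j , bound j , inj₁ vᵢ~vⱼ)
      ... | tri≈ _ i≡j _ = ⊥-elim (i≢j (toℕ-injective i≡j))
      ... | tri> _ _ j<i = λ vᵢ~vⱼ → induced _ _ (j<i , bound i , inj₁ (EC.symmetric (Pos h) vᵢ~vⱼ))

  Conn⇒AltPath : ∀ {c x y} → Consistent h c → Conn h x y → c x ≢ c y → AltPath h c x y
  Conn⇒AltPath cons x~y cx≢cy =
    let w = Conn⇒Walk x~y ; (w′ , w′-induced) = induce w (<-wellFounded (len w)) in
    Induced⇒AltPath cons w′ w′-induced cx≢cy

-- Productive queries

module _ {n : ℕ} {h : History n} where

  AltPath⇒Conn : ∀ {c x y} → AltPath h c x y → Conn h x y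
  AltPath⇒Conn ap = EC.symmetric (Link h) (Same⇒Conn start) ◅◅ reach (fromℕ _) ◅◅ Same⇒Conn end
    where
    open AltPath ap
    reachℕ : ∀ k (k<2+2h : k < suc (suc (2 * half))) → Conn h (p fzero) (p (fromℕ< k<2+2h))
    reachℕ zero    _        = ε
    reachℕ (suc k) k+1<2+2h = reachℕ k k<2+2h ◅◅
      Adj⇒Conn (consecutive _ _ (trans (toℕ-fromℕ< k+1<2+2h) (cong suc (sym (toℕ-fromℕ< k<2+2h)))))
      where k<2+2h = <-trans (n<1+n k) k+1<2+2h
    reach : ∀ i → Conn h (p fzero) (p i)
    reach i = subst (Conn h (p fzero) ∘ p) (fromℕ<-toℕ i (toℕ<n i)) (reachℕ (toℕ i) (toℕ<n i))

  Conn⇒¬Productive : ∀ {c x y} → Consistent h c → Conn h x y → ¬ Productive h c (x , y)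
  Conn⇒¬Productive cons x~y (¬core , ¬excessive) = ¬excessive (Conn⇒AltPath h cons x~y ¬core)

  ¬Conn⇒Productive : ∀ {c x y} → c x ≢ c y → ¬ Conn h x y → Productive h c (x , y)
  ¬Conn⇒Productive ¬core ¬x~y = ¬core , ¬x~y ∘ AltPath⇒Conn

  productive? : ∀ {c} → Consistent h c → ∀ q → Dec (Productive h c q)
  productive? {c} cons (x , y) with c x ≟ᵇ c y | Conn? h x y
  ... | yes core  | _        = no λ (¬core , _) → ¬core core
  ... | no  ¬core | yes x~y  = no (Conn⇒¬Productive cons x~y)
  ... | no  ¬core | no  ¬x~y = yes (¬Conn⇒Productive ¬core ¬x~y)

module _ {n : ℕ} (S : Strategy n) where

  -- record1 c (S h) ∷ h is definitionally extend h (answer c (S h)).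
  extend : History n → Bool → History n
  extend h t = (proj₁ (S h) , proj₂ (S h) , t) ∷ h

  run-next : ∀ {c h k} → ¬ Complete h → ¬ Productive h c (S h) → Run S c h k →
             Run S c (extend h (answer c (S h))) k
  run-next ¬done _     (stop done)      = ⊥-elim (¬done done)
  run-next _     ¬prod (stepP _ prod _) = ⊥-elim (¬prod prod)
  run-next _     _     (stepNP _ _ r)   = r

  run-next-productive : ∀ {c h k} → ¬ Complete h → Productive h c (S h) → Run S c h k →
                        ∃ λ k′ → k ≡ suc k′ × Run S c (extend h (answer c (S h))) k′
  run-next-productive ¬done _    (stop done)        = ⊥-elim (¬done done)
  run-next-productive _     _    (stepP _ _ r)      = _ , refl , r
  run-next-productive _     prod (stepNP _ ¬prod _) = ⊥-elim (¬prod prod)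

  run-complete : ∀ {c h k} → Complete h → Run S c h k → k ≡ 0
  run-complete _    (stop _)           = refl
  run-complete done (stepP ¬done _ _)  = ⊥-elim (¬done done)
  run-complete done (stepNP ¬done _ _) = ⊥-elim (¬done done)

  run-exists : ValidStrategy S → ∀ h c → Consistent h c → Acc _<_ (unresolved h) → ∃ (Run S c h)
  run-exists valid h c cons (acc smaller) with Complete? h
  ... | yes done  = 0 , stop done
  ... | no  ¬done with run-exists valid (extend h (answer c (S h))) c (refl ∷ cons)
                         (smaller (unresolved-query _ (valid h ¬done)))
  ...   | k , r with productive? cons (S h)
  ...     | yes prod = suc k , stepP ¬done prod r
  ...     | no ¬prod = k , stepNP ¬done ¬prod r

-- Totals over the consistent colourings

module _ {n : ℕ} where

  weight : (Coloring n → ℕ) → History n → Coloring n → ℕ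
  weight k h c = if does (consistent? h c) then k c else 0

  total : (Coloring n → ℕ) → History n → ℕ
  total k h = sumAll n (weight k h)

  count : History n → ℕ
  count = total (λ _ → 1)

  weight-cong : ∀ k {h h′ c c′} → k c ≡ k c′ → (Consistent h c ⇔ Consistent h′ c′) →
                weight k h c ≡ weight k h′ c′
  weight-cong k {h} {h′} {c} {c′} kc≡kc′ h⇔h′ =
    cong₂ (λ b v → if b then v else 0) (does-⇔ h⇔h′ (consistent? h c) (consistent? h′ c′)) kc≡kc′

  weight≢0⇒Consistent : ∀ k {h} c → weight k h c ≢ 0 → Consistent h c
  weight≢0⇒Consistent k {h} c w≢0 with consistent? h c
  ... | yes cons = cons
  ... | no  _    = ⊥-elim (w≢0 refl)

  count-respects : ∀ h → Respects≗ (weight (λ _ → 1) h)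
  count-respects h {c} {c′} c≗c′ = weight-cong (λ _ → 1) {h} {h} {c} {c′} refl (Consistent-≗ c≗c′)

  total-+ : ∀ k k₁ k₂ h → (∀ c → Consistent h c → k c ≡ k₁ c + k₂ c) →
            total k h ≡ total k₁ h + total k₂ h
  total-+ k k₁ k₂ h k≡k₁+k₂ = trans (sumAll-cong n pointwise) (sumAll-+ n _ _)
    where
    pointwise : ∀ c → weight k h c ≡ weight k₁ h c + weight k₂ h c
    pointwise c with consistent? h c
    ... | yes cons = k≡k₁+k₂ c cons
    ... | no  _    = refl

  total-zero : ∀ k h → (∀ c → Consistent h c → k c ≡ 0) → total k h ≡ 0
  total-zero k h k≡0 = trans (sumAll-cong n pointwise) (trans (sumAll-const n 0) (*-zeroʳ (2 ^ n)))
    where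
    pointwise : ∀ c → weight k h c ≡ 0
    pointwise c with consistent? h c
    ... | yes cons = k≡0 c cons
    ... | no  _    = refl

  total-split : ∀ k h ((x , y) : Fin n × Fin n) →
                total k h ≡ total k ((x , y , true) ∷ h) + total k ((x , y , false) ∷ h)
  total-split k h (x , y) =
    trans (sumAll-cong n λ c → split (answer c (x , y)) (does (consistent? h c)) (k c)) (sumAll-+ n _ _)
    where
    split : ∀ a b v → (if b then v else 0) ≡
            (if does (a ≟ᵇ true) ∧ b then v else 0) + (if does (a ≟ᵇ false) ∧ b then v else 0)
    split true  true  v = sym (+-identityʳ v)
    split false true  v = refl
    split true  false v = refl
    split false false v = refl

  count-flip : ∀ {h x y} → ¬ Conn h x y → count ((x , y , true) ∷ h) ≡ count ((x , y , false) ∷ h)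
  count-flip {h} {x} {y} ¬x~y =
    trans (sym (sumAll-⊕ n _ (count-respects ((x , y , true) ∷ h)) component))
          (sumAll-cong n λ c → weight-cong (λ _ → 1) {c = c ⊕ component} {c} refl (flipped c))
    where
    component : Coloring n
    component a = does (Conn? h x a)
    component-const : ∀ {a b t} → (a , b , t) ∈ h → component a ≡ component b
    component-const {a} {b} p = does-⇔
      (mk⇔ (_◅◅ EC.return (_ , p)) (_◅◅ EC.symmetric (Link h) (EC.return (_ , p))))
      (Conn? h x a) (Conn? h x b)
    flips-answer : ∀ c → answer (c ⊕ component) (x , y) ≡ not (answer c (x , y))
    flips-answer c = begin
      answer (c ⊕ component) (x , y)                      ≡⟨ answer-⊕ c component x y ⟩
      answer c (x , y) xor (component x xor component y)
        ≡⟨ cong₂ (λ p q → answer c (x , y) xor (p xor q)) (dec-true (Conn? h x x) ε) (dec-false (Conn? h x y) ¬x~y) ⟩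
      answer c (x , y) xor true                           ≡⟨ xor-comm _ true ⟩
      not (answer c (x , y))                              ∎
      where open ≡-Reasoning
    flipped : ∀ c → Consistent ((x , y , true) ∷ h) (c ⊕ component) ⇔ Consistent ((x , y , false) ∷ h) c
    flipped c = mk⇔
      (λ { (same ∷ cons) → not-injective (trans (sym (flips-answer c)) same)
                           ∷ to (Consistent-⊕ c component component-const) cons })
      (λ { (different ∷ cons) → trans (flips-answer c) (cong not different)
                                ∷ from (Consistent-⊕ c component component-const) cons })

count-even : ∀ {m} (h : History (suc m)) → count h ≡ 2 * sumWith₀ m (weight (λ _ → 1) h) true
count-even {m} h = sumAll-complement m _ (count-respects h) λ c →
  weight-cong (λ _ → 1) {h} {h} {c ⊕ (λ _ → true)} {c} refl
              (Consistent-⊕ c (λ _ → true) (λ _ → refl))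

count-complete : ∀ {m} {h : History (suc m)} → Complete h → count h ≤ 2
count-complete {m} {h} done = +-mono-≤ (half true) (half false)
  where
  weight≤1 : ∀ c → weight (λ _ → 1) h c ≤ 1
  weight≤1 c with does (consistent? h c)
  ... | true  = ≤-refl
  ... | false = z≤n
  half : ∀ b → sumWith₀ m (weight (λ _ → 1) h) b ≤ 1
  half b = sumAll-≤1 m _ (weight≤1 ∘ (b ∷ᶠ_)) λ c c′ w≢0 w′≢0 i →
    complete-rigid {c = b ∷ᶠ c} {b ∷ᶠ c′} done (weight≢0⇒Consistent (λ _ → 1) (b ∷ᶠ c) w≢0)
                   (weight≢0⇒Consistent (λ _ → 1) (b ∷ᶠ c′) w′≢0) fzero refl (fsuc i)

2^[1+j]≤2⇒j≡0 : ∀ j → 2 ^ suc j ≤ 2 → j ≡ 0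
2^[1+j]≤2⇒j≡0 zero    _    = refl
2^[1+j]≤2⇒j≡0 (suc j) 2^≤2 with ≤-trans (*-monoʳ-≤ 2 (*-monoʳ-≤ 2 (m^n>0 2 j))) 2^≤2
... | s≤s (s≤s ())

recombine : ∀ A B P j → 2 * A ≡ j * P → 2 * B ≡ j * P → 2 * (A + (B + P)) ≡ suc j * (2 * P)
recombine A B P j 2A≡jP 2B≡jP = begin
  2 * (A + (B + P))
    ≡⟨ solve 3 (λ A B P → con 2 :* (A :+ (B :+ P)) := con 2 :* A :+ con 2 :* B :+ con 2 :* P) refl A B P ⟩
  2 * A + 2 * B + 2 * P
    ≡⟨ cong₂ (λ a b → a + b + 2 * P) 2A≡jP 2B≡jP ⟩
  j * P + j * P + 2 * P
    ≡⟨ solve 2 (λ j P → j :* P :+ j :* P :+ con 2 :* P := (con 1 :+ j) :* (con 2 :* P)) refl j P ⟩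
  suc j * (2 * P)
    ∎
  where
  open ≡-Reasoning
  open +-*-Solver using (solve; _:+_; _:*_; con; _:=_)

module _ {m : ℕ} (S : Strategy (suc m)) where

  TotalFormula : History (suc m) → Set
  TotalFormula h = (k : Coloring (suc m) → ℕ) → (∀ c → Consistent h c → Run S c h (k c)) →
                   ∀ j → count h ≡ 2 ^ suc j → 2 * total k h ≡ j * 2 ^ suc j

  total-complete : ∀ {h} → Complete h → TotalFormula h
  total-complete {h} done k runs j count≡ = begin
    2 * total k h  ≡⟨ cong (2 *_) (total-zero k h λ c cons → run-complete S done (runs c cons)) ⟩
    0              ≡⟨ cong (λ j → j * 2 ^ suc j) j≡0 ⟨
    j * 2 ^ suc j  ∎
    where
    open ≡-Reasoning
    j≡0 = 2^[1+j]≤2⇒j≡0 j (subst (_≤ 2) count≡ (count-complete done))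

  total-connected : ∀ {h} → ¬ Complete h → uncurry (Conn h) (S h) →
                    (∀ t → TotalFormula (extend S h t)) → TotalFormula h
  total-connected {h} ¬done x~y formula k runs j count≡ =
    trans (cong (2 *_) (sym (total-extend k))) (formula t k runs′ j (trans (total-extend (λ _ → 1)) count≡))
    where
    witness : ∃ λ c → weight (λ _ → 1) h c ≢ 0
    witness = sumAll-witness (suc m) _ λ count≡0 → <⇒≢ (m^n>0 2 (suc j)) (trans (sym count≡0) count≡)
    c₀ = proj₁ witness
    t = answer c₀ (S h)
    agrees : ∀ c → Consistent h c → answer c (S h) ≡ t
    agrees c cons = from (answers-agree⇔ c c₀ _ _)
      (Conn⇒⊕-≡ c cons {c₀} (weight≢0⇒Consistent (λ _ → 1) c₀ (proj₂ witness)) x~y)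
    total-extend : ∀ k → total k (extend S h t) ≡ total k h
    total-extend k = sumAll-cong (suc m) λ c →
      weight-cong k {c = c} {c} refl (mk⇔ (λ { (_ ∷ cons) → cons }) (λ cons → agrees c cons ∷ cons))
    runs′ : ∀ c → Consistent (extend S h t) c → Run S c (extend S h t) (k c)
    runs′ c (_ ∷ cons) = subst (λ t → Run S c (extend S h t) (k c)) (agrees c cons)
      (run-next S ¬done (Conn⇒¬Productive {c = c} cons x~y) (runs c cons))

  module _ {h} (¬done : ¬ Complete h) (¬x~y : ¬ uncurry (Conn h) (S h))
           (k : Coloring (suc m) → ℕ) (runs : ∀ c → Consistent h c → Run S c h (k c)) where

    private
      hᵗ = extend S h true
      hᶠ = extend S h false

    count-halves : count h ≡ 2 * count hᵗ
    count-halves = begin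
      count h              ≡⟨ total-split (λ _ → 1) h (S h) ⟩
      count hᵗ + count hᶠ  ≡⟨ cong (count hᵗ +_) (trans (sym (count-flip ¬x~y)) (sym (+-identityʳ _))) ⟩
      2 * count hᵗ         ∎
      where open ≡-Reasoning

    runs-positive : ∀ c → Consistent hᵗ c → Run S c hᵗ (k c)
    runs-positive c (same ∷ cons) = subst (λ t → Run S c (extend S h t) (k c)) same
      (run-next S ¬done (λ (¬core , _) → ¬core (answer≡true⇒≡ c same)) (runs c cons))

    runs-negative : ∀ c → Consistent hᶠ c → ∃ λ k′ → k c ≡ suc k′ × Run S c hᶠ k′
    runs-negative c (different ∷ cons) =
      let (k′ , k≡1+k′ , r) = run-next-productive S ¬done
                                (¬Conn⇒Productive (answer≡false⇒≢ c different) ¬x~y) (runs c cons)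
      in k′ , k≡1+k′ , subst (λ t → Run S c (extend S h t) k′) different r

    runs-negative′ : ∀ c → Consistent hᶠ c → Run S c hᶠ (pred (k c))
    runs-negative′ c cons =
      let (_ , k≡1+k′ , r) = runs-negative c cons in subst (Run S c hᶠ) (cong pred (sym k≡1+k′)) r

    total-negative : total k hᶠ ≡ total (pred ∘ k) hᶠ + count hᶠ
    total-negative = total-+ k (pred ∘ k) (λ _ → 1) hᶠ λ c cons →
      let (k′ , k≡1+k′ , _) = runs-negative c cons in
      trans k≡1+k′ (trans (sym (+-comm k′ 1)) (cong (λ k → pred k + 1) (sym k≡1+k′)))

    total-disconnected : TotalFormula hᵗ → TotalFormula hᶠ →
                         ∀ j → count h ≡ 2 ^ suc j → 2 * total k h ≡ j * 2 ^ suc j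
    -- Here count hᵗ would be 1, but it is even.
    total-disconnected _ _ zero count≡2 =
      ⊥-elim (2≢1 (m*n≡1⇒m≡1 2 (sumWith₀ m (weight (λ _ → 1) hᵗ) true)
                               (trans (sym (count-even hᵗ)) countᵗ≡1)))
      where
      2≢1 : 2 ≢ 1
      2≢1 ()
      countᵗ≡1 : count hᵗ ≡ 1
      countᵗ≡1 = *-cancelˡ-≡ _ 1 2 (trans (sym count-halves) count≡2)
    total-disconnected formulaᵗ formulaᶠ (suc j) count≡ = begin
      2 * total k h            ≡⟨ cong (2 *_) (trans (total-split k h (S h)) (cong (A +_) total-negative)) ⟩
      2 * (A + (B + count hᶠ)) ≡⟨ cong (λ c → 2 * (A + (B + c))) countᶠ ⟩
      2 * (A + (B + P))        ≡⟨ recombine A B P j (formulaᵗ k runs-positive j countᵗ)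
                                                    (formulaᶠ (pred ∘ k) runs-negative′ j countᶠ) ⟩
      suc j * (2 * P)          ∎
      where
      open ≡-Reasoning
      A = total k hᵗ
      B = total (pred ∘ k) hᶠ
      P = 2 ^ suc j
      countᵗ : count hᵗ ≡ P
      countᵗ = *-cancelˡ-≡ _ _ 2 (trans (sym count-halves) count≡)
      countᶠ : count hᶠ ≡ P
      countᶠ = trans (sym (count-flip ¬x~y)) countᵗ

  total-incomplete : ∀ {h} → ¬ Complete h → (∀ t → TotalFormula (extend S h t)) → TotalFormula h
  total-incomplete {h} ¬done formula with Conn? h (proj₁ (S h)) (proj₂ (S h))
  ... | yes x~y  = total-connected ¬done x~y formula
  ... | no  ¬x~y = λ k runs → total-disconnected ¬done ¬x~y k runs (formula true) (formula false)

  total-formula : ValidStrategy S → ∀ h → Acc _<_ (unresolved h) → TotalFormula h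
  total-formula valid h (acc smaller) with Complete? h
  ... | yes done  = total-complete done
  ... | no  ¬done = total-incomplete ¬done λ t →
    total-formula valid _ (smaller (unresolved-query t (valid h ¬done)))

lemma7 : (n : ℕ) → 1 ≤ n → (S : Strategy n) → ValidStrategy S →
         ((c : Coloring n) → ∃ λ k → Run S c [] k) ×
         ((k : Coloring n → ℕ) → ((c : Coloring n) → Run S c [] (k c)) →
          2 * sumAll n k ≡ (n ∸ 1) * 2 ^ n)
lemma7 zero    ()
lemma7 (suc m) _ S valid =
  (λ c → run-exists S valid [] c [] (<-wellFounded _)) ,
  (λ k runs → total-formula S valid [] (<-wellFounded _) k (λ c _ → runs c) m all-consistent)
  where
  all-consistent : count {suc m} [] ≡ 2 ^ suc m
  all-consistent = trans (sumAll-const (suc m) 1) (*-identityʳ (2 ^ suc m))
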